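{- For every integer $t\ge 0$, if $\sigma\in B_t$ then the length of $\sigma$ is at most $3(t+1)$.
   Context: Sorting procedure: a permutation $\pi$ is processed using an input sequence (initially $\pi_1,\ldots,\pi_n$), a stack and an output. Let $m$ be the smallest value not yet output. At each step: if the stack's top entry equals $m$, pop it to the output; otherwise, if the input is nonempty, push the next input entry onto the stack. When no move is possible and the stack is nonempty, the remaining stack entries are returned to the input in the reverse of their order in the previous input (i.e. listed from top of stack to bottom), and the procedure is repeated. The rev-tier $t_{\operatorname{rev}}(\pi)$ is the number of times entries must be returned to the input before the output is $1,2,\ldots,n$. The permutations of rev-tier at most $t$ form a permutation class (closed under pattern containment); $B_t$ denotes its basis, i.e. the set of permutations not of rev-tier at most $t$ all of whose proper subpermutations (patterns contained in them) have rev-tier at most $t$. -}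

module Defs where

open import Data.Nat using (ℕ; zero; suc; _≤_; _<_; _≡ᵇ_)
open import Data.Bool using (if_then_else_)
open import Data.List using (List; []; _∷_; length; map; upTo; lookup)
open import Data.List.Relation.Binary.Permutation.Propositional using (_↭_)
open import Data.List.Relation.Binary.Sublist.Propositional using (_⊆_)
open import Data.Fin using (Fin; cast)
open import Data.Product using (Σ; ∃-syntax; _×_; _,_)
open import Relation.Binary.PropositionalEquality using (_≡_)
open import Relation.Nullary using (¬_)
open import Function.Bundles using (_⇔_)

IsPerm : List ℕ → Set
IsPerm σ = σ ↭ map suc (upTo (length σ))

-- Stacks are lists with the top entry first.
-- popAll m s: repeatedly pop while the top equals m (the smallest value
-- not yet output); returns the new m and the remaining stack.
popAll : ℕ → List ℕ → ℕ × List ℕ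
popAll m []      = m , []
popAll m (x ∷ s) = if x ≡ᵇ m then popAll (suc m) s else (m , x ∷ s)

pass : ℕ → List ℕ → List ℕ → ℕ × List ℕ
pass m s []       = popAll m s
pass m s (x ∷ xs) with popAll m s
... | m' , s' = pass m' (x ∷ s') xs

-- RevTierFrom m inp k : starting a pass with empty stack, smallest
-- not-yet-output value m and input inp, the entries are returned to the
-- input exactly k times before the procedure finishes.
-- Returning the stack listed from top to bottom gives the new input.
data RevTierFrom (m : ℕ) (inp : List ℕ) : ℕ → Set where
  done : (m' : ℕ) → pass m [] inp ≡ (m' , []) → RevTierFrom m inp zero
  again : (m' x : ℕ) (s : List ℕ) (k : ℕ) →
          pass m [] inp ≡ (m' , x ∷ s) →
          RevTierFrom m' (x ∷ s) k → RevTierFrom m inp (suc k)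

RevTier : List ℕ → ℕ → Set
RevTier σ k = RevTierFrom 1 σ k

RevTierAtMost : ℕ → List ℕ → Set
RevTierAtMost t σ = ∃[ k ] (k ≤ t × RevTier σ k)

OrderIso : List ℕ → List ℕ → Set
OrderIso a b = Σ (length a ≡ length b) λ e →
  ∀ (i j : Fin (length a)) →
    (lookup a i < lookup a j) ⇔ (lookup b (cast e i) < lookup b (cast e j))

Contains : List ℕ → List ℕ → Set
Contains σ π = ∃[ τ ] (τ ⊆ σ × OrderIso τ π)

InBasis : ℕ → List ℕ → Set
InBasis t σ =
  IsPerm σ × ¬ RevTierAtMost t σ ×
  (∀ π → IsPerm π → Contains σ π → length π < length σ → RevTierAtMost t π)

module Submission where

-- Call entries a, b, c an obstruction in a sequence if they occur in this order
-- and c < a < b.  Two facts about a single pass of the stack procedure drive the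
-- proof.  (1) If the pass ends with a nonempty stack, the awaited value m′ heads
-- an obstruction m′ b c of the pass input (b lies above m′ on the stack, and the
-- last output value c = m′ - 1 was read after b).  (2) If the input contains an
-- obstruction a b c of values not yet output, then a is never output in that pass
-- (b is pushed above a before c, hence before a, can leave), and a, b are returned
-- to the input in reversed order.
-- Consequently, if σ needs more than t returns, passes 0, …, t yield a chain of
-- t + 1 obstructions, the j-th lying in σ reversed j times, each starting no lower
-- than where the previous pass stopped (chain-of-slow-run).  Standardising the at
-- most 3(t+1) entries of the chain gives a pattern π of σ carrying the same chain
-- (chain-pattern), and by (2) any such chain forces π to need more than t returns
-- too (chain-blocks-run).  So σ ∈ B_t cannot be longer than 3(t+1).

open import Defs
open import Relation.Binary.PropositionalEquality as PE using (_≡_; _≢_; refl; sym; trans; cong; cong₂; subst; subst₂)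
open import Data.Nat using (ℕ; zero; suc; _≤_; _<_; _*_; _+_; z≤n; s≤s; _≡ᵇ_; _≤?_; _<?_; _≟_; pred)
open import Data.Nat.Properties
open import Data.Bool using (true; false; T)
open import Data.Unit using (⊤; tt)
open import Data.Empty using (⊥-elim)
open import Data.Sum using (_⊎_; inj₁; inj₂)
open import Data.Product using (∃-syntax; _×_; _,_; proj₁; proj₂)
open import Data.List using (List; []; _∷_; _++_; length; map; upTo; applyUpTo; reverse; filter; lookup; [_])
open import Data.List.Properties
  using (reverse-++; unfold-reverse; reverse-involutive; reverse-map; length-map; ++-assoc; ++-identityʳ;
         length-filter; filter-all; filter-accept; filter-reject; length-++-≤ˡ; length-++; map-upTo)
open import Data.List.Relation.Binary.Sublist.Propositional
  using (_⊆_; []; _∷_; _∷ʳ_; ⊆-refl; ⊆-trans; minimum; from∈) renaming (lookup to ⊆-lookup)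
open import Data.List.Relation.Binary.Sublist.Propositional.Properties
  using (++⁺ʳ; ++⁺; ∷ˡ⁻; reverse⁺; filter-⊆; filter⁺; map⁺; length-mono-≤)
open import Data.List.Relation.Binary.Permutation.Propositional using (_↭_; ↭-sym; ↭-trans; ↭-refl; ↭⇒↭ₛ; prep)
open import Data.List.Relation.Binary.Permutation.Propositional.Properties
  using (∈-resp-↭; ↭-length; shift; drop-∷; ¬x∷xs↭[]; ↭-reverse; All-resp-↭)
open import Data.List.Relation.Binary.Permutation.Setoid.Properties (PE.setoid ℕ) using (Unique-resp-↭)
open import Data.List.Membership.Propositional using (_∈_; _∉_)
open import Data.List.Membership.Propositional.Properties using (∈-++⁺ˡ; ∈-++⁺ʳ; ∈-++⁻; ∈-∃++; ∈-lookup)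
open import Data.List.Membership.DecPropositional _≟_ using (_∈?_)
open import Data.List.Relation.Unary.Any using (here; there)
open import Data.List.Relation.Unary.Any.Properties
  using () renaming (reverse⁺ to ∈-reverse⁺; reverse⁻ to ∈-reverse⁻)
open import Data.List.Relation.Unary.All as All using (All; []; _∷_)
open import Data.List.Relation.Unary.AllPairs using ([]; _∷_)
open import Data.List.Relation.Unary.All.Properties using (all-filter) renaming (map⁺ to All-map⁺)
open import Data.List.Relation.Unary.Unique.Propositional using (Unique)
open import Data.List.Relation.Unary.Unique.Propositional.Properties
  using (upTo⁺) renaming (map⁺ to unique-map⁺; filter⁺ to unique-filter⁺)
open import Data.Fin using (cast)
import Data.Fin as Fin
open import Function using (_∘_)
open import Function.Bundles using (mk⇔)
open import Relation.Binary using (tri<; tri≈; tri>)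
open import Relation.Nullary using (¬_; yes; no)

-- range m L = m ∷ m+1 ∷ … ∷ m+L-1.  While m is the smallest value not yet
-- output, the entries on the stack and in the input are exactly such a range.
range : ℕ → ℕ → List ℕ
range m zero    = []
range m (suc L) = m ∷ range (suc m) L

range-lower : ∀ {x} m L → x ∈ range m L → m ≤ x
range-lower m (suc L) (here refl) = ≤-refl
range-lower m (suc L) (there x∈) = <⇒≤ (range-lower (suc m) L x∈)

range-upper : ∀ {x} m L → x ∈ range m L → x < L + m
range-upper m (suc L) (here refl) = s≤s (m≤n+m m L)
range-upper {x} m (suc L) (there x∈) = subst (x <_) (+-suc L m) (range-upper (suc m) L x∈)

∈-range : ∀ {x} m L → m ≤ x → x < L + m → x ∈ range m L
∈-range m zero m≤x x<m = ⊥-elim (<⇒≱ x<m m≤x)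
∈-range {x} m (suc L) m≤x x<L+m with x ≟ m
... | yes refl = here refl
... | no x≢m   = there (∈-range (suc m) L (≤∧≢⇒< m≤x (x≢m ∘ sym)) (subst (x <_) (sym (+-suc L m)) x<L+m))

length-range : ∀ m L → length (range m L) ≡ L
length-range m zero    = refl
length-range m (suc L) = cong suc (length-range (suc m) L)

range-snoc : ∀ m k → range m (suc k) ≡ range m k ++ [ k + m ]
range-snoc m zero    = refl
range-snoc m (suc k) = cong (m ∷_) (trans (range-snoc (suc m) k) (cong (λ z → range (suc m) k ++ [ z ]) (+-suc k m)))

range-increasing : ∀ {a b} m L → a ∷ b ∷ [] ⊆ range m L → a < b
range-increasing m (suc L) (_ ∷ʳ ab⊆)   = range-increasing (suc m) L ab⊆
range-increasing m (suc L) (refl ∷ b⊆) = range-lower (suc m) L (⊆-lookup b⊆ (here refl))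

reverse-range-decreasing : ∀ {a b} m L → a ∷ b ∷ [] ⊆ reverse (range m L) → b < a
reverse-range-decreasing {a} {b} m L ab⊆ =
  range-increasing m L (subst (b ∷ a ∷ [] ⊆_) (reverse-involutive (range m L)) (reverse⁺ ab⊆))

applyUpTo-range : ∀ n (f : ℕ → ℕ) m → (∀ i → f i ≡ i + m) → applyUpTo f n ≡ range m n
applyUpTo-range zero    f m f≗ = refl
applyUpTo-range (suc n) f m f≗ =
  cong₂ _∷_ (f≗ 0) (applyUpTo-range n (f ∘ suc) (suc m) (λ i → trans (f≗ (suc i)) (sym (+-suc i m))))

upTo-range : ∀ n → map suc (upTo n) ≡ range 1 n
upTo-range n = trans (map-upTo suc n) (applyUpTo-range n suc 1 (λ i → +-comm 1 i))

isPerm⇒↭range : ∀ {σ} → IsPerm σ → σ ↭ range 1 (length σ)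
isPerm⇒↭range {σ} perm = subst (σ ↭_) (upTo-range (length σ)) perm

isPerm⇒unique : ∀ {σ} → IsPerm σ → Unique σ
isPerm⇒unique perm = Unique-resp-↭ (↭⇒↭ₛ (↭-sym perm)) (unique-map⁺ suc-injective (upTo⁺ _))

unique-split : ∀ {A : Set} (xs ys : List A) → Unique xs → All (_∈ ys) xs → ∃[ zs ] (ys ↭ xs ++ zs)
unique-split []       ys _ _ = ys , ↭-refl
unique-split (x ∷ xs) ys (x∉xs ∷ uxs) (x∈ys ∷ xs⊆ys) with ∈-∃++ x∈ys
... | A , B , refl
  with unique-split xs (A ++ B) uxs (All.zipWith (λ (y∈ , x≢y) → remove y∈ (x≢y ∘ sym)) (xs⊆ys , x∉xs))
  where
  remove : ∀ {y} → y ∈ A ++ [ x ] ++ B → y ≢ x → y ∈ A ++ B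
  remove y∈ y≢x with ∈-++⁻ A y∈
  ... | inj₁ y∈A         = ∈-++⁺ˡ y∈A
  ... | inj₂ (here y≡x)  = ⊥-elim (y≢x y≡x)
  ... | inj₂ (there y∈B) = ∈-++⁺ʳ A y∈B
...   | zs , AB↭ = zs , ↭-trans (shift x A B) (prep x AB↭)

unique-length-≤ : ∀ {A : Set} (xs ys : List A) → Unique xs → All (_∈ ys) xs → length xs ≤ length ys
unique-length-≤ xs ys uxs xs⊆ys with unique-split xs ys uxs xs⊆ys
... | zs , ys↭ = subst (length xs ≤_) (sym (↭-length ys↭)) (length-++-≤ˡ xs)

unique-in-range : ∀ m (xs : List ℕ) → Unique xs → All (_∈ range m (length xs)) xs → xs ↭ range m (length xs)
unique-in-range m xs uxs xs⊆ with unique-split xs (range m (length xs)) uxs xs⊆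
... | [] , range↭ = ↭-sym (subst (range m (length xs) ↭_) (++-identityʳ xs) range↭)
... | z ∷ zs , range↭ = ⊥-elim (m+1+n≰m (length xs) (≤-reflexive (sym lengths)))
  where
  lengths : length xs ≡ length xs + suc (length zs)
  lengths = trans (sym (length-range m (length xs))) (trans (↭-length range↭) (length-++ xs))

Blocked : ℕ → List ℕ → Set
Blocked m []      = ⊤
Blocked m (x ∷ s) = x ≢ m

PopResult : ℕ → List ℕ → ℕ × List ℕ → Set
PopResult m s (m₁ , s₁) = ∃[ k ] (m₁ ≡ k + m × s ≡ range m k ++ s₁ × Blocked m₁ s₁)

popAll-result : ∀ m s → PopResult m s (popAll m s)
popAll-result m [] = 0 , refl , refl , tt
popAll-result m (x ∷ s) with x ≡ᵇ m in x≡ᵇm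
... | false = 0 , refl , refl , λ x≡m → subst T x≡ᵇm (≡⇒≡ᵇ x m x≡m)
... | true with popAll (suc m) s | popAll-result (suc m) s
...   | m₁ , s₁ | k , m₁≡ , s≡ , blocked =
  suc k , trans m₁≡ (+-suc k m) , cong₂ _∷_ (≡ᵇ⇒≡ x m (subst T (sym x≡ᵇm) tt)) s≡ , blocked

record Pending (m : ℕ) (s rest : List ℕ) : Set where
  constructor _,_
  field
    size        : ℕ
    arrangement : s ++ rest ↭ range m size

pending-lower : ∀ {m s rest y} → Pending m s rest → y ∈ s ++ rest → m ≤ y
pending-lower {m} (L , ↭range) y∈ = range-lower m L (∈-resp-↭ ↭range y∈)

pending-stack : ∀ {m s rest y} → Pending m s rest → y ∈ s → m ≤ y
pending-stack pend y∈ = pending-lower pend (∈-++⁺ˡ y∈)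

pending-input : ∀ {m s rest y} → Pending m s rest → y ∈ rest → m ≤ y
pending-input {s = s} pend y∈ = pending-lower pend (∈-++⁺ʳ s y∈)

↭-range-drop : ∀ k m L ys → range m k ++ ys ↭ range m L → ∃[ L′ ] (ys ↭ range (k + m) L′)
↭-range-drop zero    m L       ys ↭range = L , ↭range
↭-range-drop (suc k) m zero    ys ↭range = ⊥-elim (¬x∷xs↭[] ↭range)
↭-range-drop (suc k) m (suc L) ys ↭range with ↭-range-drop k (suc m) L ys (drop-∷ ↭range)
... | L′ , ys↭ = L′ , subst (λ z → ys ↭ range z L′) (+-suc k m) ys↭

pending-pop : ∀ {m s m₁ s₁ rest} → PopResult m s (m₁ , s₁) → Pending m s rest → Pending m₁ s₁ rest
pending-pop {m} {s₁ = s₁} {rest = rest} (k , refl , refl , _) (L , ↭range)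
  with ↭-range-drop k m L (s₁ ++ rest) (subst (_↭ range m L) (++-assoc (range m k) s₁ rest) ↭range)
... | L′ , ↭range′ = L′ , ↭range′

pending-push : ∀ {m s x xs} → Pending m s (x ∷ xs) → Pending m (x ∷ s) xs
pending-push {s = s} {x} {xs} (L , ↭range) = L , ↭-trans (↭-sym (shift x s xs)) ↭range

reverse-push : ∀ {A : Set} (x : A) s xs → reverse (x ∷ s) ++ xs ≡ reverse s ++ x ∷ xs
reverse-push x s xs = trans (cong (_++ xs) (unfold-reverse x s)) (++-assoc (reverse s) [ x ] xs)

⊆-skip : ∀ {A : Set} (xs ys zs : List A) {U} → U ⊆ (xs ++ ys) ++ zs → All (_∉ ys) U → U ⊆ xs ++ zs
⊆-skip (x ∷ xs) ys zs (.x ∷ʳ U⊆) U∉ = x ∷ʳ ⊆-skip xs ys zs U⊆ U∉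
⊆-skip (x ∷ xs) ys zs (eq ∷ U⊆) (_ ∷ U∉) = eq ∷ ⊆-skip xs ys zs U⊆ U∉
⊆-skip [] [] zs U⊆ U∉ = U⊆
⊆-skip [] (y ∷ ys) zs (.y ∷ʳ U⊆) U∉ = ⊆-skip [] ys zs U⊆ (All.map (_∘ there) U∉)
⊆-skip [] (y ∷ ys) zs (refl ∷ U⊆) (y∉ ∷ _) = ⊥-elim (y∉ (here refl))

data PairIn {A : Set} (a b : A) (xs ys : List A) : Set where
  left  : a ∷ b ∷ [] ⊆ xs → PairIn a b xs ys
  split : a ∈ xs → b ∈ ys → PairIn a b xs ys
  right : a ∷ b ∷ [] ⊆ ys → PairIn a b xs ys

pair-in : ∀ {A : Set} {a b : A} (xs ys : List A) → a ∷ b ∷ [] ⊆ xs ++ ys → PairIn a b xs ys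
pair-in [] ys ab⊆ = right ab⊆
pair-in (x ∷ xs) ys (.x ∷ʳ ab⊆) with pair-in xs ys ab⊆
... | left ab⊆xs     = left (x ∷ʳ ab⊆xs)
... | split a∈xs b∈ys = split (there a∈xs) b∈ys
... | right ab⊆ys    = right ab⊆ys
pair-in (x ∷ xs) ys (refl ∷ b⊆) with ∈-++⁻ xs (⊆-lookup b⊆ (here refl))
... | inj₁ b∈xs = left (refl ∷ from∈ b∈xs)
... | inj₂ b∈ys = split (here refl) b∈ys

Retains : ℕ → List ℕ → List ℕ → Set
Retains m xs ys = ∀ {U} → U ⊆ xs → All (m ≤_) U → U ⊆ ys

above-popped : ∀ {m k U} → All (k + m ≤_) U → All (_∉ reverse (range m k)) U
above-popped {m} {k} = All.map (λ k+m≤u u∈ → <⇒≱ (range-upper m k (∈-reverse⁻ u∈)) k+m≤u)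

Triple : Set
Triple = ℕ × ℕ × ℕ

Obstructs : Triple → List ℕ → Set
Obstructs (a , b , c) xs = c < a × a < b × a ∷ b ∷ c ∷ [] ⊆ xs

Starts : ℕ → List ℕ → Set
Starts a xs = ∃[ b ] ∃[ c ] Obstructs (a , b , c) xs

final : ℕ → List ℕ → List ℕ → ℕ
final m s rest = proj₁ (pass m s rest)

leftover : ℕ → List ℕ → List ℕ → List ℕ
leftover m s rest = proj₂ (pass m s rest)

pass-pending : ∀ m s rest → Pending m s rest → Pending (final m s rest) [] (leftover m s rest)
pass-pending m s [] pend with popAll m s | popAll-result m s
... | m₁ , s₁ | popped with pending-pop {rest = []} popped pend
...   | L , ↭range = L , subst (_↭ range m₁ L) (++-identityʳ s₁) ↭range
pass-pending m s (x ∷ xs) pend with popAll m s | popAll-result m s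
... | m₁ , s₁ | popped = pass-pending m₁ (x ∷ s₁) xs (pending-push (pending-pop popped pend))

pass-progress : ∀ m s rest → m ≤ final m s rest
pass-progress m s [] with popAll m s | popAll-result m s
... | m₁ , s₁ | k , refl , _ = m≤n+m m k
pass-progress m s (x ∷ xs) with popAll m s | popAll-result m s
... | m₁ , s₁ | k , refl , _ = ≤-trans (m≤n+m m k) (pass-progress (k + m) (x ∷ s₁) xs)

pass-order : ∀ m s rest → reverse (leftover m s rest) ⊆ reverse s ++ rest
pass-order m s [] with popAll m s | popAll-result m s
... | m₁ , s₁ | k , refl , refl , _ rewrite reverse-++ (range m k) s₁ =
  ++⁺ʳ [] (++⁺ʳ (reverse (range m k)) ⊆-refl)
pass-order m s (x ∷ xs) with popAll m s | popAll-result m s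
... | m₁ , s₁ | k , refl , refl , _ rewrite reverse-++ (range m k) s₁ =
  ⊆-trans (pass-order (k + m) (x ∷ s₁) xs)
    (subst (_⊆ (reverse s₁ ++ reverse (range m k)) ++ x ∷ xs) (sym (reverse-push x s₁ xs))
       (++⁺ {as = reverse s₁} (++⁺ʳ (reverse (range m k)) ⊆-refl) ⊆-refl))

pass-retains : ∀ m s rest → Retains (final m s rest) (reverse s ++ rest) (reverse (leftover m s rest))
pass-retains m s [] {U} U⊆ U≥ with popAll m s | popAll-result m s
... | m₁ , s₁ | k , refl , refl , _ rewrite reverse-++ (range m k) s₁ =
  subst (U ⊆_) (++-identityʳ (reverse s₁))
    (⊆-skip (reverse s₁) (reverse (range m k)) [] U⊆ (above-popped {m} {k} U≥))
pass-retains m s (x ∷ xs) {U} U⊆ U≥ with popAll m s | popAll-result m s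
... | m₁ , s₁ | k , refl , refl , _ rewrite reverse-++ (range m k) s₁ =
  pass-retains (k + m) (x ∷ s₁) xs
    (subst (U ⊆_) (sym (reverse-push x s₁ xs)) (⊆-skip (reverse s₁) (reverse (range m k)) (x ∷ xs) U⊆ U∉popped))
    U≥
  where
  U∉popped : All (_∉ reverse (range m k)) U
  U∉popped = above-popped {m} {k} (All.map (≤-trans (pass-progress (k + m) (x ∷ s₁) xs)) U≥)

-- Configurations that keep the entry a from being output before the pass stops
-- (S is the stack read bottom to top, rest the unread input):
data Trapped (a : ℕ) (S rest : List ℕ) : Set where
  covered : ∀ {b} → a < b → a ∷ b ∷ [] ⊆ S → Trapped a S rest
  -- a is on the stack, and b > a will be pushed before some c < a is output;
  waiting : ∀ {b c} → c < a → a < b → a ∈ S → b ∷ c ∷ [] ⊆ rest → Trapped a S rest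
  ahead   : ∀ {b c} → Obstructs (a , b , c) rest → Trapped a S rest

trapped-step : ∀ {a m k s₁ x xs} → Pending (k + m) s₁ (x ∷ xs) →
               Trapped a (reverse (range m k ++ s₁)) (x ∷ xs) → Trapped a (reverse s₁ ++ [ x ]) xs
trapped-step {a} {m} {k} {s₁} {x} pend (covered a<b ab⊆)
  rewrite reverse-++ (range m k) s₁ with pair-in (reverse s₁) (reverse (range m k)) ab⊆
... | left ab⊆s₁      = covered a<b (++⁺ʳ [ x ] ab⊆s₁)
... | split a∈s₁ b∈popped =
  ⊥-elim (<-asym a<b (<-≤-trans (range-upper m k (∈-reverse⁻ b∈popped))
                                (pending-stack pend (∈-reverse⁻ a∈s₁))))
... | right ab⊆popped = ⊥-elim (<-asym a<b (reverse-range-decreasing m k ab⊆popped))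
trapped-step {a} {m} {k} {s₁} {x} pend (waiting c<a a<b a∈S bc⊆)
  rewrite reverse-++ (range m k) s₁ with ∈-++⁻ (reverse s₁) a∈S
... | inj₂ a∈popped =
  ⊥-elim (<-asym c<a (<-≤-trans (range-upper m k (∈-reverse⁻ a∈popped))
                                (pending-input pend (⊆-lookup (∷ˡ⁻ bc⊆) (here refl)))))
... | inj₁ a∈s₁ with bc⊆
...   | .x ∷ʳ bc⊆xs = waiting c<a a<b (∈-++⁺ˡ a∈s₁) bc⊆xs
...   | refl ∷ _    = covered a<b (++⁺ (from∈ a∈s₁) ⊆-refl)
trapped-step _ (ahead (c<a , a<b , _ ∷ʳ abc⊆xs)) = ahead (c<a , a<b , abc⊆xs)
trapped-step {s₁ = s₁} _ (ahead (c<a , a<b , refl ∷ bc⊆xs)) =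
  waiting c<a a<b (∈-++⁺ʳ (reverse s₁) (here refl)) bc⊆xs

-- A trapped entry is still present when the pass stops.  Once the input is
-- exhausted only the configuration 'covered' is possible.
pass-trapped : ∀ m s rest {a} → Pending m s rest → Trapped a (reverse s) rest → final m s rest ≤ a
pass-trapped m s [] pend (covered a<b ab⊆) with popAll m s | popAll-result m s
... | m₁ , s₁ | popped@(k , refl , refl , _) rewrite reverse-++ (range m k) s₁
  with pair-in (reverse s₁) (reverse (range m k)) ab⊆
...   | left ab⊆s₁    = pending-stack (pending-pop popped pend) (∈-reverse⁻ (⊆-lookup ab⊆s₁ (here refl)))
...   | split a∈s₁ _  = pending-stack (pending-pop popped pend) (∈-reverse⁻ a∈s₁)
...   | right ab⊆popped = ⊥-elim (<-asym a<b (reverse-range-decreasing m k ab⊆popped))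
pass-trapped m s (x ∷ xs) pend trapped with popAll m s | popAll-result m s
... | m₁ , s₁ | popped@(k , refl , refl , _) =
  pass-trapped (k + m) (x ∷ s₁) xs pend′
    (subst (λ S → Trapped _ S xs) (sym (unfold-reverse x s₁))
       (trapped-step {m = m} {k = k} (pending-pop popped pend) trapped))
  where
  pend′ : Pending (k + m) (x ∷ s₁) xs
  pend′ = pending-push (pending-pop popped pend)

-- Invariant for locating an obstruction at the end of a pass: Q is the input
-- read so far, the stack bottom to top is a subsequence of Q, and if the awaited
-- value m is on the stack, it is on top or starts an obstruction in Q.
record Tracked (m : ℕ) (s Q : List ℕ) : Set where
  constructor _,_
  field
    read    : reverse s ⊆ Q
    awaited : m ∈ s → (∃[ s₀ ] s ≡ m ∷ s₀) ⊎ Starts m Q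

-- If after popping the awaited value m₁ is still on the (blocked) stack, it starts
-- an obstruction: the entry y on top of it is larger, and the last popped value
-- m₁ - 1 was read after y.
pop-stuck : ∀ {m s m₁ s₁ Q rest} → PopResult m s (m₁ , s₁) → Pending m s rest →
            Tracked m s Q → m₁ ∈ s₁ → Starts m₁ Q
pop-stuck (zero , refl , refl , blocked) _ (_ , awaited) m∈s with awaited m∈s
... | inj₁ (_ , refl) = ⊥-elim (blocked refl)
... | inj₂ starts     = starts
pop-stuck {s₁ = y ∷ s₂} (suc k , refl , refl , blocked) _ _ (here m₁≡y) = ⊥-elim (blocked (sym m₁≡y))
pop-stuck {m} {s₁ = y ∷ s₂} popped@(suc k , refl , refl , blocked) pend (read , _) (there m₁∈s₂) =
  y , k + m , ≤-refl , m₁<y , ⊆-trans (subst (_ ⊆_) (sym reverse-stack) m₁yc⊆) read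
  where
  m₁<y : suc k + m < y
  m₁<y = ≤∧≢⇒< (pending-stack (pending-pop popped pend) (here refl)) (blocked ∘ sym)
  reverse-stack : reverse (range m (suc k) ++ y ∷ s₂) ≡ (reverse s₂ ++ [ y ]) ++ (k + m) ∷ reverse (range m k)
  reverse-stack = begin
    reverse (range m (suc k) ++ y ∷ s₂)                    ≡⟨ reverse-++ (range m (suc k)) (y ∷ s₂) ⟩
    reverse (y ∷ s₂) ++ reverse (range m (suc k))          ≡⟨ cong₂ _++_ (unfold-reverse y s₂) (cong reverse (range-snoc m k)) ⟩
    (reverse s₂ ++ [ y ]) ++ reverse (range m k ++ [ k + m ]) ≡⟨ cong (_ ++_) (reverse-++ (range m k) [ k + m ]) ⟩
    (reverse s₂ ++ [ y ]) ++ (k + m) ∷ reverse (range m k)  ∎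
    where open PE.≡-Reasoning
  m₁yc⊆ : suc k + m ∷ y ∷ k + m ∷ [] ⊆ (reverse s₂ ++ [ y ]) ++ (k + m) ∷ reverse (range m k)
  m₁yc⊆ = ++⁺ (++⁺ (from∈ (∈-reverse⁺ m₁∈s₂)) ⊆-refl) (refl ∷ minimum _)

pass-stuck : ∀ m s rest Q → Pending m s rest → Tracked m s Q → leftover m s rest ≢ [] →
             Starts (final m s rest) (Q ++ rest)
pass-stuck m s [] Q pend tracked nonempty with popAll m s | popAll-result m s
... | m₁ , s₁ | popped with pending-pop {rest = []} popped pend
...   | L , ↭range =
  subst (Starts m₁) (sym (++-identityʳ Q)) (pop-stuck popped pend tracked (awaited∈ s₁ L nonempty ↭range))
  where
  awaited∈ : ∀ s₁ L → s₁ ≢ [] → s₁ ++ [] ↭ range m₁ L → m₁ ∈ s₁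
  awaited∈ []      _       s₁≢[] _      = ⊥-elim (s₁≢[] refl)
  awaited∈ (_ ∷ _) zero    _     ↭range = ⊥-elim (¬x∷xs↭[] ↭range)
  awaited∈ s₁      (suc L) _     ↭range = subst (m₁ ∈_) (++-identityʳ s₁) (∈-resp-↭ (↭-sym ↭range) (here refl))
pass-stuck m s (x ∷ xs) Q pend tracked@(read , _) nonempty with popAll m s | popAll-result m s
... | m₁ , s₁ | popped@(k , refl , refl , _) =
  subst (Starts (final (k + m) (x ∷ s₁) xs)) (++-assoc Q [ x ] xs)
    (pass-stuck (k + m) (x ∷ s₁) xs (Q ++ [ x ]) (pending-push (pending-pop popped pend)) tracked′ nonempty)
  where
  tracked′ : Tracked (k + m) (x ∷ s₁) (Q ++ [ x ])
  tracked′ = subst (_⊆ Q ++ [ x ]) (sym (unfold-reverse x s₁)) (++⁺ s₁⊆Q ⊆-refl) , awaited′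
    where
    s₁⊆Q : reverse s₁ ⊆ Q
    s₁⊆Q = ⊆-trans (subst (reverse s₁ ⊆_) (sym (reverse-++ (range m k) s₁)) (++⁺ʳ _ ⊆-refl)) read
    awaited′ : k + m ∈ x ∷ s₁ → (∃[ s₀ ] x ∷ s₁ ≡ k + m ∷ s₀) ⊎ Starts (k + m) (Q ++ [ x ])
    awaited′ (here x≡) = inj₁ (s₁ , cong (_∷ s₁) (sym x≡))
    awaited′ (there m₁∈s₁) with pop-stuck popped pend tracked m₁∈s₁
    ... | b , c , c<a , a<b , abc⊆ = inj₂ (b , c , c<a , a<b , ++⁺ʳ [ x ] abc⊆)

record PassSummary (m : ℕ) (inp : List ℕ) (m′ : ℕ) (out : List ℕ) : Set where
  field
    pending  : Pending m′ [] out
    progress : m ≤ m′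
    order    : reverse out ⊆ inp
    retains  : Retains m′ inp (reverse out)
    trapped  : ∀ {a b c} → Obstructs (a , b , c) inp → m′ ≤ a
    stuck    : out ≢ [] → ∃[ b ] ∃[ c ] (m ≤ c × Obstructs (m′ , b , c) inp)

summarise : ∀ {m inp m′ out} → Pending m [] inp → pass m [] inp ≡ (m′ , out) → PassSummary m inp m′ out
summarise {m} {inp} pend eq = subst (λ r → PassSummary m inp (proj₁ r) (proj₂ r)) eq (record
  { pending  = pass-pending m [] inp pend
  ; progress = pass-progress m [] inp
  ; order    = pass-order m [] inp
  ; retains  = pass-retains m [] inp
  ; trapped  = λ obstruction → pass-trapped m [] inp pend (ahead obstruction)
  ; stuck    = stuck
  })
  where
  stuck : leftover m [] inp ≢ [] → ∃[ b ] ∃[ c ] (m ≤ c × Obstructs (final m [] inp , b , c) inp)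
  stuck nonempty with pass-stuck m [] inp [] pend ([] , λ ()) nonempty
  ... | b , c , c<a , a<b , abc⊆ =
    b , c , pending-input pend (⊆-lookup abc⊆ (there (there (here refl)))) , c<a , a<b , abc⊆

-- reverse^ j xs is xs reversed j times; pass j of a run on σ reads a
-- subsequence of reverse^ j σ.
reverse^ : ℕ → List ℕ → List ℕ
reverse^ zero    xs = xs
reverse^ (suc j) xs = reverse (reverse^ j xs)

reverse-⊆ : ∀ {A : Set} {U V : List A} → U ⊆ reverse V → reverse U ⊆ V
reverse-⊆ {U = U} {V = V} U⊆ = subst (reverse U ⊆_) (reverse-involutive V) (reverse⁺ U⊆)

⊆-reverse : ∀ {A : Set} {U V : List A} → reverse U ⊆ V → U ⊆ reverse V
⊆-reverse {U = U} {V = V} U⊆ = subst (_⊆ reverse V) (reverse-involutive U) (reverse⁺ U⊆)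

All-reverse : ∀ {A : Set} {P : A → Set} {U : List A} → All P U → All P (reverse U)
All-reverse {U = U} = All-resp-↭ (↭-sym (↭-reverse U))

retains-mono : ∀ {m m′ xs ys} → m ≤ m′ → Retains m xs ys → Retains m′ xs ys
retains-mono m≤m′ ret U⊆ U≥ = ret U⊆ (All.map (≤-trans m≤m′) U≥)

retains-trans : ∀ {m xs ys zs} → Retains m xs ys → Retains m ys zs → Retains m xs zs
retains-trans ret ret′ U⊆ U≥ = ret′ (ret U⊆ U≥) U≥

retains-reverse : ∀ {m xs ys} → Retains m xs ys → Retains m (reverse xs) (reverse ys)
retains-reverse ret U⊆ U≥ = ⊆-reverse (ret (reverse-⊆ U⊆) (All-reverse U≥))

obstructs-⊆ : ∀ {t xs ys} → Obstructs t xs → xs ⊆ ys → Obstructs t ys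
obstructs-⊆ (c<a , a<b , abc⊆) xs⊆ = c<a , a<b , ⊆-trans abc⊆ xs⊆

Chain : List ℕ → ℕ → ℕ → List Triple → Set
Chain X m j []                = ⊤
Chain X m j ((a , b , c) ∷ r) = m ≤ c × Obstructs (a , b , c) (reverse^ j X) × Chain X a (suc j) r

chain-mono : ∀ {X m m′ j} trs → m′ ≤ m → Chain X m j trs → Chain X m′ j trs
chain-mono []      _     _                  = tt
chain-mono (_ ∷ _) m′≤m (m≤c , obstruction , chain) = ≤-trans m′≤m m≤c , obstruction , chain

FinishesWithin : ℕ → ℕ → List ℕ → Set
FinishesWithin t m inp = ∃[ k ] (k ≤ t × RevTierFrom m inp k)

-- A run on (a subsequence of the reversals of) X that needs more than t returns
-- exhibits a chain of t + 1 obstructions in X: each unfinished pass stops on an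
-- obstruction headed by its awaited value.
chain-of-slow-run : ∀ X t j m inp → Pending m [] inp → inp ⊆ reverse^ j X →
                    ¬ FinishesWithin t m inp → ∃[ trs ] (length trs ≡ suc t × Chain X m j trs)
chain-of-slow-run X t j m inp pend inp⊆ slow with pass m [] inp in eq
... | m′ , []    = ⊥-elim (slow (0 , z≤n , done m′ eq))
... | m′ , x ∷ s with PassSummary.stuck (summarise pend eq) (λ ()) | later t slow
  where
  open PassSummary (summarise pend eq)
  later : ∀ t → ¬ FinishesWithin t m inp → ∃[ trs ] (length trs ≡ t × Chain X m′ (suc j) trs)
  later zero    _    = [] , refl , tt
  later (suc t) slow = chain-of-slow-run X t (suc j) m′ (x ∷ s) pending (⊆-reverse (⊆-trans order inp⊆))
    λ (k , k≤t , run) → slow (suc k , s≤s k≤t , again m′ x s k eq run)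
...   | b , c , m≤c , obstruction | trs , length≡ , chain =
  (m′ , b , c) ∷ trs , cong suc length≡ , m≤c , obstructs-⊆ obstruction inp⊆ , chain

-- Conversely, a chain of more than k obstructions in Y whose entries survive in
-- the input rules out finishing after exactly k returns: the head of each
-- obstruction is trapped, so the pass leaves it on the stack below a larger entry.
chain-blocks-run : ∀ Y j p inp k trs → Pending p [] inp → Retains p (reverse^ j Y) inp →
                   Chain Y p j trs → k < length trs → ¬ RevTierFrom p inp k
chain-blocks-run Y j p inp k ((a , b , c) ∷ r) pend retained (p≤c , (c<a , a<b , abc⊆) , chain) = blocked
  where
  p≤a : p ≤ a
  p≤a = ≤-trans p≤c (<⇒≤ c<a)
  abc∈inp : a ∷ b ∷ c ∷ [] ⊆ inp
  abc∈inp = retained abc⊆ (p≤a ∷ ≤-trans p≤a (<⇒≤ a<b) ∷ p≤c ∷ [])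
  survives : ∀ {m′ out} → pass p [] inp ≡ (m′ , out) → m′ ≤ a × a ∷ b ∷ [] ⊆ reverse out
  survives eq = m′≤a , retains (⊆-trans (refl ∷ refl ∷ c ∷ʳ []) abc∈inp) (m′≤a ∷ ≤-trans m′≤a (<⇒≤ a<b) ∷ [])
    where
    open PassSummary (summarise pend eq)
    m′≤a = trapped (c<a , a<b , abc∈inp)
  blocked : ∀ {k} → k < suc (length r) → ¬ RevTierFrom p inp k
  blocked _ (done m′ eq) with survives eq
  ... | _ , ()
  blocked (s≤s k<len) (again m′ x s k eq run) =
    chain-blocks-run Y (suc j) m′ (x ∷ s) k r pending retained′ (chain-mono r (proj₁ (survives eq)) chain) k<len run
    where
    open PassSummary (summarise pend eq)
    retained′ : Retains m′ (reverse^ (suc j) Y) (x ∷ s)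
    retained′ = subst (Retains m′ (reverse^ (suc j) Y)) (reverse-involutive (x ∷ s))
                  (retains-reverse (retains-trans (retains-mono progress retained) retains))

below : List ℕ → ℕ → ℕ
below xs x = length (filter (_<? x) xs)

rank : List ℕ → ℕ → ℕ
rank xs x = suc (below xs x)

below-cons-< : ∀ {z x} xs → z < x → below (z ∷ xs) x ≡ suc (below xs x)
below-cons-< {z} {x} xs z<x = cong length (filter-accept (_<? x) z<x)

below-cons-≮ : ∀ {z x} xs → ¬ z < x → below (z ∷ xs) x ≡ below xs x
below-cons-≮ {z} {x} xs z≮x = cong length (filter-reject (_<? x) z≮x)

below-mono : ∀ xs {x y} → x ≤ y → below xs x ≤ below xs y
below-mono xs {x} {y} x≤y =
  length-mono-≤ (filter⁺ (_<? x) (_<? y) (λ { refl z<x → <-≤-trans z<x x≤y }) (⊆-refl {x = xs}))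

below-strict : ∀ xs {x y} → x ∈ xs → x < y → below xs x < below xs y
below-strict (z ∷ xs) {y = y} (here refl) z<y rewrite below-cons-≮ {z} {z} xs (<-irrefl refl) | below-cons-< xs z<y =
  s≤s (below-mono xs (<⇒≤ z<y))
below-strict (z ∷ xs) {x} {y} (there x∈) x<y with z <? x | z <? y
... | yes z<x | yes z<y rewrite below-cons-< xs z<x | below-cons-< xs z<y = s≤s (below-strict xs x∈ x<y)
... | yes z<x | no  z≮y = ⊥-elim (z≮y (<-trans z<x x<y))
... | no  z≮x | yes z<y rewrite below-cons-≮ xs z≮x | below-cons-< xs z<y = m<n⇒m<1+n (below-strict xs x∈ x<y)
... | no  z≮x | no  z≮y rewrite below-cons-≮ xs z≮x | below-cons-≮ xs z≮y = below-strict xs x∈ x<y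

below-bound : ∀ xs {x} → x ∈ xs → below xs x < length xs
below-bound (z ∷ xs) (here refl) rewrite below-cons-≮ {z} {z} xs (<-irrefl refl) = s≤s (length-filter (_<? z) xs)
below-bound (z ∷ xs) {x} (there x∈) with z <? x
... | yes z<x rewrite below-cons-< xs z<x = s≤s (below-bound xs x∈)
... | no  z≮x rewrite below-cons-≮ xs z≮x = m<n⇒m<1+n (below-bound xs x∈)

rank-mono : ∀ xs {x y} → x ≤ y → rank xs x ≤ rank xs y
rank-mono xs x≤y = s≤s (below-mono xs x≤y)

rank-strict : ∀ xs {x y} → x ∈ xs → x < y → rank xs x < rank xs y
rank-strict xs x∈ x<y = s≤s (below-strict xs x∈ x<y)

rank-reflects : ∀ xs {x y} → y ∈ xs → rank xs x < rank xs y → x < y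
rank-reflects xs {x} {y} y∈ rx<ry with x <? y
... | yes x<y = x<y
... | no  x≮y = ⊥-elim (<⇒≱ rx<ry (rank-mono xs (≮⇒≥ x≮y)))

rank-injective : ∀ xs {x y} → x ∈ xs → y ∈ xs → rank xs x ≡ rank xs y → x ≡ y
rank-injective xs {x} {y} x∈ y∈ rx≡ry with <-cmp x y
... | tri< x<y _ _ = ⊥-elim (<-irrefl rx≡ry (rank-strict xs x∈ x<y))
... | tri≈ _ x≡y _ = x≡y
... | tri> _ _ y<x = ⊥-elim (<-irrefl (sym rx≡ry) (rank-strict xs y∈ y<x))

standardise : List ℕ → List ℕ
standardise xs = map (rank xs) xs

lookup-map : ∀ (f : ℕ → ℕ) (xs : List ℕ) (e : length xs ≡ length (map f xs)) i →
             lookup (map f xs) (cast e i) ≡ f (lookup xs i)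
lookup-map f (x ∷ xs) e Fin.zero    = refl
lookup-map f (x ∷ xs) e (Fin.suc i) = lookup-map f xs (cong pred e) i

standardise-iso : ∀ xs → OrderIso xs (standardise xs)
standardise-iso xs = e , λ i j → mk⇔ (to i j) (from i j)
  where
  e : length xs ≡ length (standardise xs)
  e = sym (length-map (rank xs) xs)
  to : ∀ i j → lookup xs i < lookup xs j → lookup (standardise xs) (cast e i) < lookup (standardise xs) (cast e j)
  to i j xi<xj = subst₂ _<_ (sym (lookup-map (rank xs) xs e i)) (sym (lookup-map (rank xs) xs e j))
                   (rank-strict xs (∈-lookup i) xi<xj)
  from : ∀ i j → lookup (standardise xs) (cast e i) < lookup (standardise xs) (cast e j) → lookup xs i < lookup xs j
  from i j ri<rj =
    rank-reflects xs (∈-lookup j) (subst₂ _<_ (lookup-map (rank xs) xs e i) (lookup-map (rank xs) xs e j) ri<rj)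

standardise-perm : ∀ xs → Unique xs → IsPerm (standardise xs)
standardise-perm xs uxs = subst (standardise xs ↭_) (sym (upTo-range _))
                            (unique-in-range 1 (standardise xs) (distinct xs (All.tabulate (λ x∈ → x∈)) uxs) in-range)
  where
  len : length (standardise xs) ≡ length xs
  len = length-map (rank xs) xs
  distinct : ∀ ys → All (_∈ xs) ys → Unique ys → Unique (map (rank xs) ys)
  distinct [] _ _ = []
  distinct (y ∷ ys) (y∈ ∷ ys∈) (y∉ys ∷ uys) = fresh ys ys∈ y∉ys ∷ distinct ys ys∈ uys
    where
    fresh : ∀ zs → All (_∈ xs) zs → All (y ≢_) zs → All (rank xs y ≢_) (map (rank xs) zs)
    fresh [] _ _ = []
    fresh (z ∷ zs) (z∈ ∷ zs∈) (y≢z ∷ y≢zs) = (y≢z ∘ rank-injective xs y∈ z∈) ∷ fresh zs zs∈ y≢zs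
  in-range : All (_∈ range 1 (length (standardise xs))) (standardise xs)
  in-range = All-map⁺ (All.tabulate λ {x} x∈ → subst (λ n → rank xs x ∈ range 1 n) (sym len)
               (∈-range 1 (length xs) (s≤s z≤n) (subst (rank xs x <_) (+-comm 1 (length xs)) (s≤s (below-bound xs x∈)))))

entries : List Triple → List ℕ
entries []                = []
entries ((a , b , c) ∷ r) = a ∷ b ∷ c ∷ entries r

length-entries : ∀ trs → length (entries trs) ≡ 3 * length trs
length-entries []      = refl
length-entries (_ ∷ r) = trans (cong (3 +_) (length-entries r)) (sym (*-suc 3 (length r)))

map-triple : (ℕ → ℕ) → Triple → Triple
map-triple f (a , b , c) = f a , f b , f c

restrict : List ℕ → List ℕ → List ℕ
restrict σ T = filter (_∈? T) σ

⊆-restrict : ∀ σ T j {U} → U ⊆ reverse^ j σ → All (_∈ T) U → U ⊆ reverse^ j (restrict σ T)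
⊆-restrict σ T zero {U} U⊆ U∈T =
  subst (_⊆ restrict σ T) (filter-all (_∈? T) U∈T) (filter⁺ (_∈? T) (_∈? T) (λ { refl x∈ → x∈ }) U⊆)
⊆-restrict σ T (suc j) U⊆ U∈T = ⊆-reverse (⊆-restrict σ T j (reverse-⊆ U⊆) (All-reverse U∈T))

∈-reverse^ : ∀ j {x xs} → x ∈ reverse^ j xs → x ∈ xs
∈-reverse^ zero    x∈ = x∈
∈-reverse^ (suc j) x∈ = ∈-reverse^ j (∈-reverse⁻ x∈)

map-reverse^ : ∀ (f : ℕ → ℕ) j xs → reverse^ j (map f xs) ≡ map f (reverse^ j xs)
map-reverse^ f zero    xs = refl
map-reverse^ f (suc j) xs = trans (cong reverse (map-reverse^ f j xs)) (sym (reverse-map f (reverse^ j xs)))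

chain-standardise : ∀ σ T j m q trs → Chain σ m j trs → All (_∈ T) (entries trs) →
                    q ≤ rank (restrict σ T) m →
                    Chain (standardise (restrict σ T)) q j (map (map-triple (rank (restrict σ T))) trs)
chain-standardise σ T j m q [] _ _ _ = tt
chain-standardise σ T j m q ((a , b , c) ∷ r) (m≤c , (c<a , a<b , abc⊆) , chain) (a∈T ∷ b∈T ∷ c∈T ∷ r∈T) q≤ =
  ≤-trans q≤ (rank-mono τ m≤c) , (rank-strict τ c∈τ c<a , rank-strict τ a∈τ a<b , ranked⊆) ,
  chain-standardise σ T (suc j) a (rank τ a) r chain r∈T ≤-refl
  where
  τ = restrict σ T
  abc⊆τ : a ∷ b ∷ c ∷ [] ⊆ reverse^ j τ
  abc⊆τ = ⊆-restrict σ T j abc⊆ (a∈T ∷ b∈T ∷ c∈T ∷ [])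
  a∈τ : a ∈ τ
  a∈τ = ∈-reverse^ j (⊆-lookup abc⊆τ (here refl))
  c∈τ : c ∈ τ
  c∈τ = ∈-reverse^ j (⊆-lookup abc⊆τ (there (there (here refl))))
  ranked⊆ : rank τ a ∷ rank τ b ∷ rank τ c ∷ [] ⊆ reverse^ j (standardise τ)
  ranked⊆ = subst (rank τ a ∷ rank τ b ∷ rank τ c ∷ [] ⊆_) (sym (map-reverse^ (rank τ) j τ))
              (map⁺ (rank τ) abc⊆τ)

record ChainPattern (σ : List ℕ) (n : ℕ) : Set where
  field
    π            : List ℕ
    perm         : IsPerm π
    contained    : Contains σ π
    short        : length π ≤ 3 * n
    links        : List Triple
    chain        : Chain π 1 0 links
    length-links : length links ≡ n

chain-pattern : ∀ {σ} trs → IsPerm σ → Chain σ 1 0 trs → ChainPattern σ (length trs)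
chain-pattern {σ} trs perm chain = record
  { π            = standardise τ
  ; perm         = standardise-perm τ unique-τ
  ; contained    = τ , filter-⊆ (_∈? E) σ , standardise-iso τ
  ; short        = begin
      length (standardise τ) ≡⟨ length-map (rank τ) τ ⟩
      length τ               ≤⟨ unique-length-≤ τ E unique-τ (all-filter (_∈? E) σ) ⟩
      length E               ≡⟨ length-entries trs ⟩
      3 * length trs         ∎
  ; links        = map (map-triple (rank τ)) trs
  ; chain        = chain-standardise σ E 0 1 1 trs chain (All.tabulate (λ x∈ → x∈)) (s≤s z≤n)
  ; length-links = length-map (map-triple (rank τ)) trs
  }
  where
  open ≤-Reasoning
  E = entries trs
  τ = restrict σ E
  unique-τ : Unique τ
  unique-τ = unique-filter⁺ (_∈? E) (isPerm⇒unique perm)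

slow-chain : ∀ {σ} t → IsPerm σ → ¬ RevTierAtMost t σ → ∃[ trs ] (length trs ≡ suc t × Chain σ 1 0 trs)
slow-chain {σ} t perm slow = chain-of-slow-run σ t 0 1 σ (length σ , isPerm⇒↭range perm) ⊆-refl slow

chain-slow : ∀ {π} t trs → IsPerm π → Chain π 1 0 trs → t < length trs → ¬ RevTierAtMost t π
chain-slow {π} t trs perm chain t<len (k , k≤t , run) =
  chain-blocks-run π 0 1 π k trs (length π , isPerm⇒↭range perm) (λ U⊆ _ → U⊆) chain (≤-<-trans k≤t t<len) run

-- A permutation of rev-tier > t whose proper patterns have rev-tier ≤ t has at
-- most 3(t+1) entries: otherwise the pattern of a chain of t+1 obstructions is
-- proper and still of rev-tier > t.
mainTheorem5 : (t : ℕ) (σ : List ℕ) → InBasis t σ → length σ ≤ 3 * suc t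
mainTheorem5 t σ (perm , slow , minimal) with length σ ≤? 3 * suc t
... | yes short = short
... | no long with slow-chain t perm slow
...   | trs , length≡ , chain =
  ⊥-elim (chain-slow t links perm′ chain′ t<links (minimal π perm′ contained π-shorter))
  where
  open ChainPattern (chain-pattern trs perm chain) renaming (perm to perm′; chain to chain′)
  π-shorter : length π < length σ
  π-shorter = ≤-<-trans (subst (λ n → length π ≤ 3 * n) length≡ short) (≰⇒> long)
  t<links : t < length links
  t<links = subst (t <_) (sym (trans length-links length≡)) ≤-refl
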